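{- Let $M$ and $N$ be models of $\mathrm{ZF}^-$, let $j, k : M \to N$ preserve and reflect $\Sigma_0$ formulas, let $X \in M$ and let $\mathfrak{F}$ be a filter on $X$ (not necessarily in $M$). Suppose $\{x \in X : j(x) = k(x)\} \in \mathfrak{F}$, and let $f : X \to Y$, $f \in M$, be a function each of whose fibres $f^{ -1}(\{y\})$, $y\in Y$, is $\mathfrak{F}$-positive. If $j(f) = k(f)$, then $j|_Y = k|_Y$.
   Context: $\mathrm{ZF}^-$ is ZF without the power set axiom. A set $S \subseteq X$ is $\mathfrak{F}$-positive if it meets every element of $\mathfrak{F}$. -}

module Defs where

open import Data.Nat using (ℕ; suc)
open import Data.Fin using (Fin; zero; suc)
open import Data.Product using (Σ; ∃; ∃-syntax; _×_; _,_)
open import Data.Sum using (_⊎_)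
open import Data.Empty using (⊥)
open import Data.Vec.Functional using (_∷_)
open import Relation.Nullary using (¬_)
open import Relation.Binary.PropositionalEquality using (_≡_)
open import Function using (_∘_; _⇔_)

-- Structures for the language {∈} of set theory (equality is identity)

record Structure : Set₁ where
  field
    Carrier : Set
    _∈_     : Carrier → Carrier → Set

open Structure public using (Carrier)

mem : (M : Structure) → Carrier M → Carrier M → Set
mem = Structure._∈_

-- First-order formulas with n free variables (de Bruijn, variable 0 is
-- the innermost bound one).

data Formula : ℕ → Set where
  _∈'_  : ∀ {n} → Fin n → Fin n → Formula n
  _≈'_  : ∀ {n} → Fin n → Fin n → Formula n
  ⊥'    : ∀ {n} → Formula n
  _⇒'_  : ∀ {n} → Formula n → Formula n → Formula n
  _∧'_  : ∀ {n} → Formula n → Formula n → Formula n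
  _∨'_  : ∀ {n} → Formula n → Formula n → Formula n
  ∀'    : ∀ {n} → Formula (suc n) → Formula n
  ∃'    : ∀ {n} → Formula (suc n) → Formula n
  ∀∈'   : ∀ {n} → Fin n → Formula (suc n) → Formula n
  ∃∈'   : ∀ {n} → Fin n → Formula (suc n) → Formula n

data IsΣ₀ : ∀ {n} → Formula n → Set where
  ∈-Σ₀  : ∀ {n} (a b : Fin n) → IsΣ₀ (a ∈' b)
  ≈-Σ₀  : ∀ {n} (a b : Fin n) → IsΣ₀ (a ≈' b)
  ⊥-Σ₀  : ∀ {n} → IsΣ₀ {n} ⊥'
  ⇒-Σ₀  : ∀ {n} {φ ψ : Formula n} → IsΣ₀ φ → IsΣ₀ ψ → IsΣ₀ (φ ⇒' ψ)
  ∧-Σ₀  : ∀ {n} {φ ψ : Formula n} → IsΣ₀ φ → IsΣ₀ ψ → IsΣ₀ (φ ∧' ψ)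
  ∨-Σ₀  : ∀ {n} {φ ψ : Formula n} → IsΣ₀ φ → IsΣ₀ ψ → IsΣ₀ (φ ∨' ψ)
  ∀∈-Σ₀ : ∀ {n} (v : Fin n) {φ : Formula (suc n)} → IsΣ₀ φ → IsΣ₀ (∀∈' v φ)
  ∃∈-Σ₀ : ∀ {n} (v : Fin n) {φ : Formula (suc n)} → IsΣ₀ φ → IsΣ₀ (∃∈' v φ)

Sat : (M : Structure) → ∀ {n} → Formula n → (Fin n → Carrier M) → Set
Sat M (a ∈' b) ρ = mem M (ρ a) (ρ b)
Sat M (a ≈' b) ρ = ρ a ≡ ρ b
Sat M ⊥' ρ = ⊥
Sat M (φ ⇒' ψ) ρ = Sat M φ ρ → Sat M ψ ρ
Sat M (φ ∧' ψ) ρ = Sat M φ ρ × Sat M ψ ρ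
Sat M (φ ∨' ψ) ρ = Sat M φ ρ ⊎ Sat M ψ ρ
Sat M (∀' φ) ρ = (x : Carrier M) → Sat M φ (x ∷ ρ)
Sat M (∃' φ) ρ = Σ (Carrier M) λ x → Sat M φ (x ∷ ρ)
Sat M (∀∈' v φ) ρ = (x : Carrier M) → mem M x (ρ v) → Sat M φ (x ∷ ρ)
Sat M (∃∈' v φ) ρ = Σ (Carrier M) λ x → mem M x (ρ v) × Sat M φ (x ∷ ρ)

-- M ⊨ ZF⁻  (ZF without power set), axioms written out semantically;
-- schemas range over all formulas with parameters.

record IsZF⁻ (M : Structure) : Set where
  open Structure M renaming (Carrier to C)
  field
    extensionality : ∀ (a b : C) → (∀ z → (z ∈ a) ⇔ (z ∈ b)) → a ≡ b
    pairing        : ∀ (a b : C) → ∃[ c ] (a ∈ c × b ∈ c)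
    union          : ∀ (a : C) → ∃[ u ] (∀ y z → z ∈ y → y ∈ a → z ∈ u)
    infinity       : ∃[ w ] ((∃[ e ] (e ∈ w × (∀ z → ¬ (z ∈ e))))
                          × (∀ y → y ∈ w → ∃[ s ] (s ∈ w × (∀ z → (z ∈ s) ⇔ (z ∈ y ⊎ z ≡ y)))))
    separation     : ∀ {n} (φ : Formula (suc n)) (ρ : Fin n → C) (a : C) →
                     ∃[ b ] (∀ z → (z ∈ b) ⇔ (z ∈ a × Sat M φ (z ∷ ρ)))
    replacement    : ∀ {n} (φ : Formula (suc (suc n))) (ρ : Fin n → C) (a : C) →
                     (∀ x → x ∈ a → ∃[ y ] (Sat M φ (y ∷ x ∷ ρ)
                                   × (∀ y' → Sat M φ (y' ∷ x ∷ ρ) → y' ≡ y))) →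
                     ∃[ b ] (∀ y → (y ∈ b) ⇔ (∃[ x ] (x ∈ a × Sat M φ (y ∷ x ∷ ρ))))
    foundation     : ∀ (a : C) → (∃[ y ] (y ∈ a)) → ∃[ y ] (y ∈ a × (∀ z → z ∈ y → ¬ (z ∈ a)))

PreservesReflectsΣ₀ : (M N : Structure) → (Carrier M → Carrier N) → Set
PreservesReflectsΣ₀ M N j =
  ∀ {n} (φ : Formula n) → IsΣ₀ φ → (ρ : Fin n → Carrier M) →
  Sat M φ ρ ⇔ Sat N φ (j ∘ ρ)

module _ (M : Structure) where
  open Structure M renaming (Carrier to C)

  IsUPair : C → C → C → Set
  IsUPair z a b = ∀ w → (w ∈ z) ⇔ (w ≡ a ⊎ w ≡ b)

  IsOrdPair : C → C → C → Set
  IsOrdPair p a b = ∀ z → (z ∈ p) ⇔ (IsUPair z a a ⊎ IsUPair z a b)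

  Graph : C → C → C → Set
  Graph f x y = ∃[ p ] (p ∈ f × IsOrdPair p x y)

  IsFunction : C → C → C → Set
  IsFunction f X Y =
      (∀ p → p ∈ f → ∃[ x ] ∃[ y ] (x ∈ X × y ∈ Y × IsOrdPair p x y))
    × (∀ x → x ∈ X → ∃[ y ] Graph f x y)
    × (∀ x y y' → Graph f x y → Graph f x y' → y ≡ y')

  -- Subsets of (the extension of) X ∈ M, not necessarily in M: predicates
  Subset : Set₁
  Subset = C → Set

  record IsFilter (X : C) (𝔉 : Subset → Set) : Set₁ where
    field
      ⊆X       : ∀ S → 𝔉 S → ∀ x → S x → x ∈ X
      whole    : 𝔉 (λ x → x ∈ X)
      ∩-closed : ∀ S T → 𝔉 S → 𝔉 T → 𝔉 (λ x → S x × T x)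
      upward   : ∀ S T → 𝔉 S → (∀ x → S x → T x) → (∀ x → T x → x ∈ X) → 𝔉 T
      proper   : ¬ 𝔉 (λ _ → ⊥)

  Positive : (Subset → Set) → Subset → Set₁
  Positive 𝔉 S = ∀ A → 𝔉 A → ∃[ x ] (S x × A x)

  Fibre : C → C → C → Subset
  Fibre X f y x = x ∈ X × Graph f x y

{-# OPTIONS --safe #-}

-- Positivity of the fibre over y, tested against the agreement set of j and k, yields
-- x ∈ X with f(x) = y and j(x) = k(x).  The statement f(x) = y splits into two Σ₀
-- facts: ⟨x, y⟩ ∈ f, and every v with ⟨x, v⟩ ∈ f equals y.  Transport the first
-- along j and the second along k; as j(f) = k(f) and j(x) = k(x), the pair
-- ⟨j(x), j(y)⟩ ∈ k(f) produced by the first is subject to the second, so j(y) = k(y).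
module Submission where

open import Defs
open import Data.Nat using (suc)
open import Data.Fin using (Fin; zero; suc)
open import Data.Product using (∃-syntax; _×_; _,_; proj₂)
open import Data.Sum using (inj₁; inj₂; [_,_]) renaming (map to ⊎-map)
open import Data.Vec.Functional using (_∷_; [])
open import Relation.Binary.PropositionalEquality using (_≡_; refl; subst; subst₂)
open import Function using (_∘_; _⇔_; Equivalence; mk⇔)

open Equivalence

isUPair : ∀ {n} → Fin n → Fin n → Fin n → Formula n
isUPair z a b = ∀∈' z ((zero ≈' suc a) ∨' (zero ≈' suc b)) ∧' ((a ∈' z) ∧' (b ∈' z))

isUPair-Σ₀ : ∀ {n} (z a b : Fin n) → IsΣ₀ (isUPair z a b)
isUPair-Σ₀ z a b =
  ∧-Σ₀ (∀∈-Σ₀ z (∨-Σ₀ (≈-Σ₀ _ _) (≈-Σ₀ _ _))) (∧-Σ₀ (∈-Σ₀ a z) (∈-Σ₀ b z))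

isOrdPair : ∀ {n} → Fin n → Fin n → Fin n → Formula n
isOrdPair p a b =
  ∀∈' p (isUPair zero (suc a) (suc a) ∨' isUPair zero (suc a) (suc b))
  ∧' (∃∈' p (isUPair zero (suc a) (suc a)) ∧' ∃∈' p (isUPair zero (suc a) (suc b)))

isOrdPair-Σ₀ : ∀ {n} (p a b : Fin n) → IsΣ₀ (isOrdPair p a b)
isOrdPair-Σ₀ p a b =
  ∧-Σ₀ (∀∈-Σ₀ p (∨-Σ₀ (isUPair-Σ₀ _ _ _) (isUPair-Σ₀ _ _ _)))
       (∧-Σ₀ (∃∈-Σ₀ p (isUPair-Σ₀ _ _ _)) (∃∈-Σ₀ p (isUPair-Σ₀ _ _ _)))

graph : ∀ {n} → Fin n → Fin n → Fin n → Formula n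
graph f x y = ∃∈' f (isOrdPair zero (suc x) (suc y))

graph-Σ₀ : ∀ {n} (f x y : Fin n) → IsΣ₀ (graph f x y)
graph-Σ₀ f x y = ∃∈-Σ₀ f (isOrdPair-Σ₀ _ _ _)

-- The quantifier over v can be bounded because v ∈ {x, v} ∈ ⟨x, v⟩ ∈ f.
isOnlyValue : ∀ {n} → Fin n → Fin n → Fin n → Formula n
isOnlyValue f x y = ∀∈' f (∀∈' zero (∀∈' zero
  (isOrdPair (suc (suc zero)) (suc (suc (suc x))) zero ⇒' (zero ≈' suc (suc (suc y))))))

isOnlyValue-Σ₀ : ∀ {n} (f x y : Fin n) → IsΣ₀ (isOnlyValue f x y)
isOnlyValue-Σ₀ f x y =
  ∀∈-Σ₀ f (∀∈-Σ₀ _ (∀∈-Σ₀ _ (⇒-Σ₀ (isOrdPair-Σ₀ _ _ _) (≈-Σ₀ _ _))))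

IsOnlyValue : (M : Structure) → Carrier M → Carrier M → Carrier M → Set
IsOnlyValue M f x y = ∀ v → Graph M f x v → v ≡ y

module _ (M : Structure) where
  open Structure M renaming (Carrier to C)

  sat-isUPair : ∀ {n} (z a b : Fin n) (ρ : Fin n → C) →
                Sat M (isUPair z a b) ρ ⇔ IsUPair M (ρ z) (ρ a) (ρ b)
  sat-isUPair z a b ρ = mk⇔
    (λ (h , a∈z , b∈z) w → mk⇔ (h w) λ { (inj₁ refl) → a∈z ; (inj₂ refl) → b∈z })
    (λ u → (λ w → to (u w)) , from (u (ρ a)) (inj₁ refl) , from (u (ρ b)) (inj₂ refl))

module _ {M : Structure} (ZM : IsZF⁻ M) where
  open Structure M renaming (Carrier to C)
  open IsZF⁻ ZM

  upair-unique : ∀ {z z' a b} → IsUPair M z a b → IsUPair M z' a b → z ≡ z'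
  upair-unique u u' = extensionality _ _ λ w →
    mk⇔ (from (u' w) ∘ to (u w)) (from (u w) ∘ to (u' w))

  upair-exists : ∀ a b → ∃[ z ] IsUPair M z a b
  upair-exists a b with pairing a b
  ... | c , a∈c , b∈c
    with separation ((zero ≈' suc zero) ∨' (zero ≈' suc (suc zero))) (a ∷ b ∷ []) c
  ... | z , z-spec = z , λ w → mk⇔ (proj₂ ∘ to (z-spec w))
    λ { (inj₁ refl) → from (z-spec w) (a∈c , inj₁ refl)
      ; (inj₂ refl) → from (z-spec w) (b∈c , inj₂ refl) }

  sat-isOrdPair : ∀ {n} (p a b : Fin n) (ρ : Fin n → C) →
                  Sat M (isOrdPair p a b) ρ ⇔ IsOrdPair M (ρ p) (ρ a) (ρ b)
  sat-isOrdPair p a b ρ = mk⇔ sound complete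
    where
    upair : ∀ c d w →
            Sat M (isUPair zero (suc c) (suc d)) (w ∷ ρ) ⇔ IsUPair M w (ρ c) (ρ d)
    upair c d w = sat-isUPair M zero (suc c) (suc d) (w ∷ ρ)

    sound : Sat M (isOrdPair p a b) ρ → IsOrdPair M (ρ p) (ρ a) (ρ b)
    sound (h , (s , s∈p , s-sat) , (t , t∈p , t-sat)) z = mk⇔
      (⊎-map (to (upair a a z)) (to (upair a b z)) ∘ h z)
      [ (λ u → subst (_∈ ρ p) (upair-unique (to (upair a a s) s-sat) u) s∈p)
      , (λ u → subst (_∈ ρ p) (upair-unique (to (upair a b t) t-sat) u) t∈p) ]

    complete : IsOrdPair M (ρ p) (ρ a) (ρ b) → Sat M (isOrdPair p a b) ρ
    complete o =
      let (s , s-upair) = upair-exists (ρ a) (ρ a)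
          (t , t-upair) = upair-exists (ρ a) (ρ b)
      in (λ z → ⊎-map (from (upair a a z)) (from (upair a b z)) ∘ to (o z))
         , (s , from (o s) (inj₁ s-upair) , from (upair a a s) s-upair)
         , (t , from (o t) (inj₂ t-upair) , from (upair a b t) t-upair)

  sat-graph : ∀ {n} (f x y : Fin n) (ρ : Fin n → C) →
              Sat M (graph f x y) ρ ⇔ Graph M (ρ f) (ρ x) (ρ y)
  sat-graph f x y ρ = mk⇔
    (λ (p , p∈f , s) → p , p∈f , to (pair p) s)
    (λ (p , p∈f , o) → p , p∈f , from (pair p) o)
    where
    pair : ∀ p → Sat M (isOrdPair zero (suc x) (suc y)) (p ∷ ρ) ⇔ IsOrdPair M p (ρ x) (ρ y)
    pair p = sat-isOrdPair zero (suc x) (suc y) (p ∷ ρ)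

  sat-isOnlyValue : ∀ {n} (f x y : Fin n) (ρ : Fin n → C) →
                    Sat M (isOnlyValue f x y) ρ ⇔ IsOnlyValue M (ρ f) (ρ x) (ρ y)
  sat-isOnlyValue f x y ρ = mk⇔ sound complete
    where
    pair : ∀ p a v → Sat M (isOrdPair (suc (suc zero)) (suc (suc (suc x))) zero) (v ∷ a ∷ p ∷ ρ)
                     ⇔ IsOrdPair M p (ρ x) v
    pair p a v = sat-isOrdPair (suc (suc zero)) (suc (suc (suc x))) zero (v ∷ a ∷ p ∷ ρ)

    sound : Sat M (isOnlyValue f x y) ρ → IsOnlyValue M (ρ f) (ρ x) (ρ y)
    sound s v (p , p∈f , o) =
      let (a , a-upair) = upair-exists (ρ x) v
      in s p p∈f a (from (o a) (inj₂ a-upair)) v (from (a-upair v) (inj₂ refl))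
           (from (pair p a v) o)

    complete : IsOnlyValue M (ρ f) (ρ x) (ρ y) → Sat M (isOnlyValue f x y) ρ
    complete h p p∈f a _ v _ s = h v (p , p∈f , to (pair p a v) s)

module _ {M N : Structure} (ZM : IsZF⁻ M) (ZN : IsZF⁻ N)
         {j : Carrier M → Carrier N} (j-Σ₀ : PreservesReflectsΣ₀ M N j) where

  preserves-Graph : ∀ {f x y} → Graph M f x y → Graph N (j f) (j x) (j y)
  preserves-Graph {f} {x} {y} =
    to (sat-graph ZN zero (suc zero) (suc (suc zero)) (j ∘ ρ))
    ∘ to (j-Σ₀ (graph zero (suc zero) (suc (suc zero))) (graph-Σ₀ _ _ _) ρ)
    ∘ from (sat-graph ZM zero (suc zero) (suc (suc zero)) ρ)
    where
    ρ : Fin 3 → Carrier M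
    ρ = f ∷ x ∷ y ∷ []

  preserves-IsOnlyValue : ∀ {f x y} → IsOnlyValue M f x y → IsOnlyValue N (j f) (j x) (j y)
  preserves-IsOnlyValue {f} {x} {y} =
    to (sat-isOnlyValue ZN zero (suc zero) (suc (suc zero)) (j ∘ ρ))
    ∘ to (j-Σ₀ (isOnlyValue zero (suc zero) (suc (suc zero))) (isOnlyValue-Σ₀ _ _ _) ρ)
    ∘ from (sat-isOnlyValue ZM zero (suc zero) (suc (suc zero)) ρ)
    where
    ρ : Fin 3 → Carrier M
    ρ = f ∷ x ∷ y ∷ []

value-agree : ∀ {M N} → IsZF⁻ M → IsZF⁻ N → {j k : Carrier M → Carrier N} →
              PreservesReflectsΣ₀ M N j → PreservesReflectsΣ₀ M N k →
              ∀ {f x y} → Graph M f x y → IsOnlyValue M f x y →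
              j f ≡ k f → j x ≡ k x → j y ≡ k y
value-agree {N = N} ZM ZN {j} {k} j-Σ₀ k-Σ₀ {y = y} x↦y only-y jf≡kf jx≡kx =
  preserves-IsOnlyValue ZM ZN k-Σ₀ only-y (j y)
    (subst₂ (λ g u → Graph N g u (j y)) jf≡kf jx≡kx (preserves-Graph ZM ZN j-Σ₀ x↦y))

mainTheorem5 :
    (M N : Structure) → IsZF⁻ M → IsZF⁻ N →
    (j k : Carrier M → Carrier N) →
    PreservesReflectsΣ₀ M N j → PreservesReflectsΣ₀ M N k →
    (X Y f : Carrier M) (𝔉 : Subset M → Set) → IsFilter M X 𝔉 →
    𝔉 (λ x → mem M x X × j x ≡ k x) →
    IsFunction M f X Y →
    (∀ y → mem M y Y → Positive M 𝔉 (Fibre M X f y)) →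
    j f ≡ k f →
    ∀ y → mem M y Y → j y ≡ k y
mainTheorem5 M N ZM ZN j k j-Σ₀ k-Σ₀ X Y f 𝔉 _ agree∈𝔉 (_ , _ , single-valued)
             positive jf≡kf y y∈Y
  with positive y y∈Y _ agree∈𝔉
... | x , (_ , x↦y) , (_ , jx≡kx) =
  value-agree ZM ZN j-Σ₀ k-Σ₀ x↦y (λ v x↦v → single-valued x v y x↦v x↦y) jf≡kf jx≡kx
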